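{- Let $p$ be an odd prime and let $d\in\mathbb{Z}$ with $\left(\frac dp\right)=-1$. Then $$\prod_{x=1}^{(p-1)/2}(x^2-d)\equiv(-1)^{(p+1)/2}\,2\pmod p.$$
   Context: $\left(\frac{\cdot}{p}\right)$ denotes the Legendre symbol modulo $p$. -}

module Defs where

open import Data.Nat using (ℕ; zero; suc)
open import Data.Integer using (ℤ; +_; _-_; _*_; -_)
open import Data.Integer.Divisibility using (_∣_)
open import Data.Product using (_×_; ∃)
open import Relation.Nullary using (¬_)

_≡_[mod_] : ℤ → ℤ → ℕ → Set
a ≡ b [mod m ] = (+ m) ∣ (a - b)

IsSquareMod : ℕ → ℤ → Set
IsSquareMod p d = ∃ λ (x : ℤ) → (x * x) ≡ d [mod p ]

-- Legendre symbol (d/p) = -1: d is coprime to p (p ∤ d) and d is not a square mod p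
LegendreMinusOne : ℕ → ℤ → Set
LegendreMinusOne p d = ¬ ((+ p) ∣ d) × ¬ IsSquareMod p d

prodFrom1 : ℕ → (ℕ → ℤ) → ℤ
prodFrom1 zero    f = + 1
prodFrom1 (suc n) f = prodFrom1 n f * f (suc n)

negOnePow : ℕ → ℤ
negOnePow zero    = + 1
negOnePow (suc n) = - negOnePow n

module Submission where

-- The squares 1², ..., k² are pairwise incongruent mod p and each is a root of
-- t^k - 1 mod p by Fermat's little theorem.  The polynomial ∏_{x=1}^{k} (t - x²)
-- - (t^k - 1) has degree < k and these k roots, so by Lagrange's root bound it
-- vanishes mod p at every t.  At t = d the product is nonzero mod p (d is not a
-- square), so d^k ≢ 1 and hence, as d^(2k) ≡ 1, d^k ≡ -1 (Euler's criterion).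
-- Therefore ∏ (d - x²) ≡ d^k - 1 ≡ -2, and reversing the k factors gives the sign.

open import Defs
open import Function using (id; _∘_)
open import Data.Nat as ℕ using (ℕ; zero; suc; pred; _<_; _≤_; _∸_; z≤n; s≤s; _!; _/_; _%_)
import Data.Nat.Properties as ℕ
open import Data.Nat.Divisibility using (_∣_; _∤_; >⇒∤; m∣m*n; m%n≡0⇒n∣m)
open import Data.Nat.DivMod using (m/n*n≡m; m%n<n; m≡m%n+[m/n]*n; m*n/n≡m)
open import Data.Nat.Primality using (Prime; euclidsLemma; prime⇒nonTrivial; ¬prime[0]; ¬prime[1])
open import Data.Nat.Combinatorics using (_C_; nCn≡1; nCk≡n!/k![n-k]!; k![n∸k]!∣n!)
open import Data.Integer using (ℤ; +_; -[1+_]; _+_; _-_; _*_; -_; _^_; 0ℤ; 1ℤ; ∣_∣)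
open import Data.Integer.Properties
  using (abs-*; +-*-commutativeSemiring; +-*-semiring; +-identityˡ; +-identityʳ; *-identityˡ;
         *-zeroʳ; *-assoc; *-distribʳ-+; ^-zeroˡ; ^-*-assoc; m-n≡m⊖n; ⊖-≥)
import Data.Integer.Divisibility.Signed as Signed
open Signed using (divides; ∣ᵤ⇒∣; ∣⇒∣ᵤ; ∣m∣n⇒∣m+n; ∣m+n∣m⇒∣n; ∣m+n∣n⇒∣m; ∣n⇒∣m*n; ∣m⇒∣m*n; ∣m⇒∣-m)
open import Data.Integer.Tactic.RingSolver using (solve-∀)
open import Data.Fin using (Fin; zero; suc; toℕ; inject₁; fromℕ)
open import Data.Fin.Properties using (toℕ-inject₁; toℕ-fromℕ; toℕ<n)
open import Data.Vec.Functional using (Vector; init)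
open import Data.List using (List; []; _∷_; length; map)
open import Data.List.Properties using (length-map)
open import Data.Product using (Σ; _×_; _,_)
open import Data.Sum using (_⊎_; inj₁; inj₂; [_,_]′)
open import Data.Empty using (⊥-elim)
open import Relation.Nullary using (¬_; yes; no)
open import Relation.Binary.PropositionalEquality using (_≡_; refl; subst; sym; trans; cong; cong₂; module ≡-Reasoning)
import Algebra.Properties.CommutativeSemiring.Binomial as Binomial
import Algebra.Properties.Semiring.Exp as Exp
import Algebra.Properties.Semiring.Mult as Mult
import Algebra.Properties.Semiring.Sum as Sum

prime>1 : ∀ {p} → Prime p → 1 < p
prime>1 {p} pr = ℕ.nonTrivial⇒n>1 p {{prime⇒nonTrivial pr}}

prime∤! : ∀ {p} → Prime p → ∀ m → m < p → p ∤ m !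
prime∤! pr zero    _   = >⇒∤ (prime>1 pr)
prime∤! pr (suc m) m<p p∣m! =
  [ >⇒∤ m<p , prime∤! pr m (ℕ.<-trans (ℕ.n<1+n m) m<p) ]′ (euclidsLemma (suc m) (m !) pr p∣m!)

-- A prime p divides every inner binomial coefficient p C k, 0 < k < p, since
-- (p C k) * k! (p-k)! = p! while p divides p! but neither k! nor (p-k)!.
prime∣choose : ∀ {p k} → Prime p → 0 < k → k < p → p ∣ p C k
prime∣choose {p@(suc q)} {k} pr 0<k k<p =
  [ id , (λ p∣k![p-k]! → ⊥-elim ([ prime∤! pr k k<p , prime∤! pr (p ∸ k) p-k<p ]′
                                    (euclidsLemma (k !) ((p ∸ k) !) pr p∣k![p-k]!))) ]′
    (euclidsLemma (p C k) (k ! ℕ.* (p ∸ k) !) pr (subst (p ∣_) (sym pCk*k![p-k]!≡p!) (m∣m*n (q !))))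
  where
  instance _ = ℕ._!*_!≢0 k (p ∸ k)
  p-k<p : p ∸ k < p
  p-k<p = ℕ.∸-monoʳ-< 0<k (ℕ.<⇒≤ k<p)
  pCk*k![p-k]!≡p! : (p C k) ℕ.* (k ! ℕ.* (p ∸ k) !) ≡ p !
  pCk*k![p-k]!≡p! = trans (cong (ℕ._* (k ! ℕ.* (p ∸ k) !)) (nCk≡n!/k![n-k]! (ℕ.<⇒≤ k<p)))
                          (m/n*n≡m (k![n∸k]!∣n! (ℕ.<⇒≤ k<p)))

infix 4 _∣ℤ_
_∣ℤ_ : ℕ → ℤ → Set
n ∣ℤ x = + n Signed.∣ x

euclid : ∀ {p} → Prime p → ∀ a b → p ∣ℤ a * b → p ∣ℤ a ⊎ p ∣ℤ b
euclid {p} pr a b p∣ab =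
  [ inj₁ ∘ ∣ᵤ⇒∣ , inj₂ ∘ ∣ᵤ⇒∣ ]′ (euclidsLemma ∣ a ∣ ∣ b ∣ pr (subst (p ∣_) (abs-* a b) (∣⇒∣ᵤ p∣ab)))

∤-small : ∀ {p m} → 0 < m → m < p → ¬ (p ∣ℤ + m)
∤-small {m = suc m} _ m<p p∣m = >⇒∤ m<p (∣⇒∣ᵤ p∣m)

∣-flip : ∀ {p x y} → p ∣ℤ x - y → p ∣ℤ y - x
∣-flip {p} {x} {y} h = subst (p ∣ℤ_) (negate x y) (∣m⇒∣-m h)
  where
  negate : ∀ x y → - (x - y) ≡ y - x
  negate = solve-∀

-- The library's binomial theorem, instantiated at the commutative semiring ℤ; it is
-- phrased with the generic power x ^ˢ n and the generic multiple n ×ˢ x = x + ... + x.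
module ℤˢ where
  open Binomial +-*-commutativeSemiring public using (binomialTerm; theorem)
  open Exp +-*-semiring public using () renaming (_^_ to _^ˢ_)
  open Sum +-*-semiring public using (sum; sum-init-last)
  open Mult +-*-semiring public using () renaming (_×_ to _×ˢ_)

open ℤˢ

^ˢ≡^ : ∀ x n → x ^ˢ n ≡ x ^ n
^ˢ≡^ x zero    = refl
^ˢ≡^ x (suc n) = cong (x *_) (^ˢ≡^ x n)

×ˢ≡* : ∀ n x → n ×ˢ x ≡ + n * x
×ˢ≡* zero    x = refl
×ˢ≡* (suc n) x = begin
  x + n ×ˢ x          ≡⟨ cong (_+_ x) (×ˢ≡* n x) ⟩
  x + + n * x         ≡⟨ cong (_+ + n * x) (*-identityˡ x) ⟨
  1ℤ * x + + n * x    ≡⟨ *-distribʳ-+ x 1ℤ (+ n) ⟨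
  + suc n * x         ∎
  where open ≡-Reasoning

binomialTerm-first : ∀ x n → binomialTerm 1ℤ x n zero ≡ x ^ n
binomialTerm-first x n = trans (+-identityʳ _) (trans (*-identityˡ _) (^ˢ≡^ x n))

binomialTerm-last : ∀ x n → binomialTerm 1ℤ x n (fromℕ n) ≡ 1ℤ
binomialTerm-last x n = begin
  binomialTerm 1ℤ x n (fromℕ n)                     ≡⟨ ×ˢ≡* (n C toℕ (fromℕ n)) _ ⟩
  + (n C toℕ (fromℕ n)) * (1ℤ ^ˢ toℕ (fromℕ n) * x ^ˢ (n ∸ toℕ (fromℕ n)))
     ≡⟨ cong (λ k → + (n C k) * (1ℤ ^ˢ k * x ^ˢ (n ∸ k))) (toℕ-fromℕ n) ⟩
  + (n C n) * (1ℤ ^ˢ n * x ^ˢ (n ∸ n))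
     ≡⟨ cong₂ (λ c u → + c * (u * x ^ˢ (n ∸ n))) (nCn≡1 n) (trans (^ˢ≡^ 1ℤ n) (^-zeroˡ n)) ⟩
  1ℤ * (1ℤ * x ^ˢ (n ∸ n))                          ≡⟨ cong (λ k → 1ℤ * (1ℤ * x ^ˢ k)) (ℕ.n∸n≡0 n) ⟩
  1ℤ ∎
  where open ≡-Reasoning

∣-sum : ∀ {d n} (f : Vector ℤ n) → (∀ i → d ∣ℤ f i) → d ∣ℤ sum f
∣-sum {n = zero}  f d∣f = divides 0ℤ refl
∣-sum {n = suc n} f d∣f = ∣m∣n⇒∣m+n (d∣f zero) (∣-sum (f ∘ suc) (d∣f ∘ suc))

∣-×ˢ : ∀ {d n} y → d ∣ n → d ∣ℤ n ×ˢ y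
∣-×ˢ {d} {n} y d∣n = subst (d ∣ℤ_) (sym (×ˢ≡* n y)) (∣m⇒∣m*n {m = + n} y (∣ᵤ⇒∣ d∣n))

-- (1 + x)^p ≡ 1 + x^p (mod p): in the binomial expansion every inner term
-- carries a coefficient p C i with 0 < i < p.
frobenius : ∀ {p} → Prime p → ∀ x → p ∣ℤ (1ℤ + x) ^ p - (1ℤ + x ^ p)
frobenius {zero}          pr = ⊥-elim (¬prime[0] pr)
frobenius {suc zero}      pr = ⊥-elim (¬prime[1] pr)
frobenius {p@(suc (suc m))} pr x = subst (p ∣ℤ_) (sym expansion) (∣-sum inner p∣inner)
  where
  term : Fin (suc p) → ℤ
  term = binomialTerm 1ℤ x p
  inner : Vector ℤ (suc m)
  inner = init (term ∘ suc)
  p∣inner : ∀ i → p ∣ℤ inner i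
  p∣inner i = ∣-×ˢ _ (prime∣choose pr (s≤s z≤n) (s≤s (subst (_< suc m) (sym (toℕ-inject₁ i)) (toℕ<n i))))
  expansion : (1ℤ + x) ^ p - (1ℤ + x ^ p) ≡ sum inner
  expansion = begin
    (1ℤ + x) ^ p - (1ℤ + x ^ p)                          ≡⟨ cong (_- (1ℤ + x ^ p)) (sym (^ˢ≡^ (1ℤ + x) p)) ⟩
    (1ℤ + x) ^ˢ p - (1ℤ + x ^ p)                         ≡⟨ cong (_- (1ℤ + x ^ p)) (theorem p 1ℤ x) ⟩
    (term zero + sum (term ∘ suc)) - (1ℤ + x ^ p)        ≡⟨ cong (λ s → (term zero + s) - (1ℤ + x ^ p)) (sum-init-last (term ∘ suc)) ⟩
    (term zero + (sum inner + term (fromℕ p))) - (1ℤ + x ^ p)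
        ≡⟨ cong₂ (λ a b → (a + (sum inner + b)) - (1ℤ + x ^ p)) (binomialTerm-first x p) (binomialTerm-last x p) ⟩
    (x ^ p + (sum inner + 1ℤ)) - (1ℤ + x ^ p)            ≡⟨ cancel (x ^ p) (sum inner) ⟩
    sum inner                                            ∎
    where
    open ≡-Reasoning
    cancel : ∀ a s → (a + (s + 1ℤ)) - (1ℤ + a) ≡ s
    cancel = solve-∀

-- Fermat's little theorem x^p ≡ x (mod p), by induction over ℤ in both directions:
-- the change of x^p - x from x to 1 + x is the Frobenius defect of x.
fermat : ∀ {p} → Prime p → ∀ x → p ∣ℤ x ^ p - x
fermat {zero}      pr = ⊥-elim (¬prime[0] pr)
fermat {p@(suc _)} pr = go
  where
  step : ∀ x → (1ℤ + x) ^ p - (1ℤ + x) ≡ ((1ℤ + x) ^ p - (1ℤ + x ^ p)) + (x ^ p - x)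
  step x = shift ((1ℤ + x) ^ p) (x ^ p) x
    where
    shift : ∀ a b x → a - (1ℤ + x) ≡ (a - (1ℤ + b)) + (b - x)
    shift = solve-∀
  up : ∀ x → p ∣ℤ x ^ p - x → p ∣ℤ (1ℤ + x) ^ p - (1ℤ + x)
  up x h = subst (p ∣ℤ_) (sym (step x)) (∣m∣n⇒∣m+n (frobenius pr x) h)
  down : ∀ x → p ∣ℤ (1ℤ + x) ^ p - (1ℤ + x) → p ∣ℤ x ^ p - x
  down x h = ∣m+n∣m⇒∣n (subst (p ∣ℤ_) (step x) h) (frobenius pr x)
  go : ∀ x → p ∣ℤ x ^ p - x
  go (+ zero)        = divides 0ℤ refl
  go (+ suc n)       = up (+ n) (go (+ n))
  go -[1+ zero ]     = down -[1+ zero ] (go (+ zero))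
  go -[1+ suc n ]    = down -[1+ suc n ] (go -[1+ n ])

-- For x not divisible by the prime p = m + 1: x^m ≡ 1 (mod p),
-- since p divides x^p - x = x (x^m - 1) but not x.
fermat-unit : ∀ {m} → Prime (suc m) → ∀ x → ¬ (suc m ∣ℤ x) → suc m ∣ℤ x ^ m - 1ℤ
fermat-unit {m} pr x p∤x =
  [ ⊥-elim ∘ p∤x , id ]′
    (euclid pr x (x ^ m - 1ℤ) (subst (suc m ∣ℤ_) (factor x (x ^ m)) (fermat pr x)))
  where
  factor : ∀ x y → x * y - x ≡ x * (y - 1ℤ)
  factor = solve-∀

square^ : ∀ x j → (x * x) ^ j ≡ x ^ (j ℕ.* 2)
square^ x zero    = refl
square^ x (suc j) = trans (cong ((x * x) *_) (square^ x j)) (*-assoc x x (x ^ (j ℕ.* 2)))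

-- Value at t of the polynomial with coefficient list cs (constant term first), by Horner's rule.
eval : List ℤ → ℤ → ℤ
eval []       t = 0ℤ
eval (c ∷ cs) t = c + t * eval cs t

add : List ℤ → List ℤ → List ℤ
add []       ys       = ys
add (x ∷ xs) []       = x ∷ xs
add (x ∷ xs) (y ∷ ys) = x + y ∷ add xs ys

scale : ℤ → List ℤ → List ℤ
scale c = map (c *_)

eval-add : ∀ xs ys t → eval (add xs ys) t ≡ eval xs t + eval ys t
eval-add []       ys       t = sym (+-identityˡ _)
eval-add (x ∷ xs) []       t = sym (+-identityʳ _)
eval-add (x ∷ xs) (y ∷ ys) t = trans (cong (λ s → x + y + t * s) (eval-add xs ys t)) (regroup x y t (eval xs t) (eval ys t))
  where
  regroup : ∀ x y t a b → x + y + t * (a + b) ≡ (x + t * a) + (y + t * b)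
  regroup = solve-∀

eval-scale : ∀ c xs t → eval (scale c xs) t ≡ c * eval xs t
eval-scale c []       t = sym (*-zeroʳ c)
eval-scale c (x ∷ xs) t = trans (cong (λ s → c * x + t * s) (eval-scale c xs t)) (distribute c x t (eval xs t))
  where
  distribute : ∀ c x t a → c * x + t * (c * a) ≡ c * (x + t * a)
  distribute = solve-∀

length-add : ∀ {n} xs ys → length xs ≤ n → length ys ≤ n → length (add xs ys) ≤ n
length-add []       ys       _         ys≤n      = ys≤n
length-add (x ∷ xs) []       xs≤n      _         = xs≤n
length-add (x ∷ xs) (y ∷ ys) (s≤s xs≤n) (s≤s ys≤n) = s≤s (length-add xs ys xs≤n ys≤n)

-- Synthetic division by t - a: if cs = c + t·g then
-- (cs(t) - cs(a)) / (t - a) = g(t) + a · (g(t) - g(a)) / (t - a).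
quotient : ℤ → List ℤ → List ℤ
quotient a []       = []
quotient a (c ∷ cs) = add cs (scale a (quotient a cs))

quotient-spec : ∀ a cs t → eval cs t ≡ (t - a) * eval (quotient a cs) t + eval cs a
quotient-spec a []       t = sym (vanish t a)
  where
  vanish : ∀ t a → (t - a) * 0ℤ + 0ℤ ≡ 0ℤ
  vanish = solve-∀
quotient-spec a (c ∷ cs) t = begin
  c + t * g t                                            ≡⟨ cong (λ u → c + t * u) (quotient-spec a cs t) ⟩
  c + t * ((t - a) * q + g a)                            ≡⟨ divide c t a q (g a) ⟩
  (t - a) * (((t - a) * q + g a) + a * q) + (c + a * g a)
                                                         ≡⟨ cong (λ u → (t - a) * (u + a * q) + (c + a * g a)) (quotient-spec a cs t) ⟨
  (t - a) * (g t + a * q) + (c + a * g a)                ≡⟨ cong (λ u → (t - a) * u + (c + a * g a)) eval-quotient ⟨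
  (t - a) * eval (quotient a (c ∷ cs)) t + (c + a * g a) ∎
  where
  open ≡-Reasoning
  g : ℤ → ℤ
  g = eval cs
  q : ℤ
  q = eval (quotient a cs) t
  eval-quotient : eval (quotient a (c ∷ cs)) t ≡ g t + a * q
  eval-quotient = trans (eval-add cs _ t) (cong (_+_ (g t)) (eval-scale a (quotient a cs) t))
  divide : ∀ c t a q g → c + t * ((t - a) * q + g) ≡ (t - a) * (((t - a) * q + g) + a * q) + (c + a * g)
  divide = solve-∀

quotient-length : ∀ a cs → length (quotient a cs) ≤ pred (length cs)
quotient-length a []       = z≤n
quotient-length a (c ∷ cs) = length-add cs (scale a (quotient a cs)) ℕ.≤-refl
  (subst (_≤ length cs) (sym (length-map (a *_) (quotient a cs))) (ℕ.≤-trans (quotient-length a cs) ℕ.pred[n]≤n))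

DegreeBelow : ℕ → (ℤ → ℤ) → Set
DegreeBelow n f = Σ (List ℤ) λ cs → length cs ≤ n × (∀ t → f t ≡ eval cs t)

module _ {n : ℕ} where

  deg-ext : ∀ {f g} → (∀ t → f t ≡ g t) → DegreeBelow n f → DegreeBelow n g
  deg-ext f≗g (cs , len , f≗cs) = cs , len , λ t → trans (sym (f≗g t)) (f≗cs t)

  deg-weaken : ∀ {m f} → n ≤ m → DegreeBelow n f → DegreeBelow m f
  deg-weaken n≤m (cs , len , f≗cs) = cs , ℕ.≤-trans len n≤m , f≗cs

  deg-+ : ∀ {f g} → DegreeBelow n f → DegreeBelow n g → DegreeBelow n (λ t → f t + g t)
  deg-+ (cs , cs≤n , f≗cs) (ds , ds≤n , g≗ds) =
    add cs ds , length-add cs ds cs≤n ds≤n , λ t → trans (cong₂ _+_ (f≗cs t) (g≗ds t)) (sym (eval-add cs ds t))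

  deg-scale : ∀ {f} c → DegreeBelow n f → DegreeBelow n (λ t → c * f t)
  deg-scale c (cs , len , f≗cs) =
    scale c cs , subst (_≤ n) (sym (length-map (c *_) cs)) len , λ t → trans (cong (c *_) (f≗cs t)) (sym (eval-scale c cs t))

  deg-shift : ∀ {f} → DegreeBelow n f → DegreeBelow (suc n) (λ t → t * f t)
  deg-shift (cs , len , f≗cs) = 0ℤ ∷ cs , s≤s len , λ t → trans (cong (t *_) (f≗cs t)) (sym (+-identityˡ _))

deg-const : ∀ c → DegreeBelow 1 (λ _ → c)
deg-const c = c ∷ [] , s≤s z≤n , λ t → sym (trans (cong (_+_ c) (*-zeroʳ t)) (+-identityʳ c))

deg-pow : ∀ m → DegreeBelow (suc m) (λ t → t ^ m)
deg-pow zero    = deg-const 1ℤ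
deg-pow (suc m) = deg-shift (deg-pow m)

deg-divide : ∀ {n f} → DegreeBelow (suc n) f → ∀ a →
             Σ (ℤ → ℤ) λ q → DegreeBelow n q × (∀ t → f t ≡ (t - a) * q t + f a)
deg-divide (cs , len , f≗cs) a =
  eval (quotient a cs) , (quotient a cs , ℕ.≤-trans (quotient-length a cs) (ℕ.pred-mono-≤ len) , λ _ → refl) ,
  λ t → trans (f≗cs t) (trans (quotient-spec a cs t) (cong (_+_ ((t - a) * eval (quotient a cs) t)) (sym (f≗cs a))))

-- ∏_{x=1}^m (t - r x) is monic of degree m: subtracting t^m leaves degree < m.
deg-monicProduct : ∀ (r : ℕ → ℤ) m → DegreeBelow m (λ t → prodFrom1 m (λ x → t - r x) - t ^ m)
deg-monicProduct r zero    = [] , z≤n , λ t → refl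
deg-monicProduct r (suc m) = deg-ext expand
  (deg-+ (deg-shift rest) (deg-scale (- r (suc m)) (deg-+ (deg-weaken (ℕ.n≤1+n m) rest) (deg-pow m))))
  where
  P : ℤ → ℤ
  P t = prodFrom1 m (λ x → t - r x)
  rest : DegreeBelow m (λ t → P t - t ^ m)
  rest = deg-monicProduct r m
  expand : ∀ t → t * (P t - t ^ m) + - r (suc m) * ((P t - t ^ m) + t ^ m) ≡ P t * (t - r (suc m)) - t * t ^ m
  expand t = identity t (P t) (t ^ m) (r (suc m))
    where
    identity : ∀ t P T a → t * (P - T) + - a * ((P - T) + T) ≡ P * (t - a) - t * T
    identity = solve-∀

-- Divide by t - a (n-1); the quotient vanishes at the other points, since p is prime.
rootBound : ∀ {p} → Prime p → ∀ n (a : ℕ → ℤ) → (∀ i j → j < i → i < n → ¬ (p ∣ℤ a i - a j)) →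
            ∀ {f} → DegreeBelow n f → (∀ i → i < n → p ∣ℤ f (a i)) → ∀ t → p ∣ℤ f t
rootBound {p} pr zero    a distinct ([] , _ , f≗0) roots t = subst (p ∣ℤ_) (sym (f≗0 t)) (divides 0ℤ refl)
rootBound {p} pr (suc n) a distinct {f} degf roots t with deg-divide degf (a n)
... | q , degq , f≡ = subst (p ∣ℤ_) (sym (f≡ t)) (∣m∣n⇒∣m+n (∣n⇒∣m*n (t - a n) (q-vanishes t)) (roots n (ℕ.n<1+n n)))
  where
  q-root : ∀ i → i < n → p ∣ℤ q (a i)
  q-root i i<n =
    [ (λ p∣aᵢ-aₙ → ⊥-elim (distinct n i i<n (ℕ.n<1+n n) (∣-flip {x = a i} p∣aᵢ-aₙ))) , id ]′
      (euclid pr (a i - a n) (q (a i))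
        (∣m+n∣n⇒∣m (subst (p ∣ℤ_) (f≡ (a i)) (roots i (ℕ.m≤n⇒m≤1+n i<n))) (roots n (ℕ.n<1+n n))))
  q-vanishes : ∀ t → p ∣ℤ q t
  q-vanishes = rootBound pr n a (λ i j j<i i<n → distinct i j j<i (ℕ.m≤n⇒m≤1+n i<n)) degq q-root

prodFrom1-zero : ∀ (f : ℕ → ℤ) {m x} → 0 < x → x ≤ m → f x ≡ 0ℤ → prodFrom1 m f ≡ 0ℤ
prodFrom1-zero f {zero}  () z≤n _
prodFrom1-zero f {suc m} {x} 0<x x≤1+m fx≡0 with x ℕ.≟ suc m
... | yes refl = trans (cong (prodFrom1 m f *_) fx≡0) (*-zeroʳ (prodFrom1 m f))
... | no  x≢1+m = cong (_* f (suc m)) (prodFrom1-zero f 0<x (ℕ.≤-pred (ℕ.≤∧≢⇒< x≤1+m x≢1+m)) fx≡0)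

prime∤prodFrom1 : ∀ {p} → Prime p → ∀ (f : ℕ → ℤ) m → (∀ x → ¬ p ∣ℤ f x) → ¬ p ∣ℤ prodFrom1 m f
prime∤prodFrom1 pr f zero    p∤f = ∤-small (s≤s z≤n) (prime>1 pr)
prime∤prodFrom1 pr f (suc m) p∤f p∣∏ =
  [ prime∤prodFrom1 pr f m p∤f , p∤f (suc m) ]′ (euclid pr (prodFrom1 m f) (f (suc m)) p∣∏)

prodFrom1-flip : ∀ (a b : ℕ → ℤ) m → prodFrom1 m (λ x → a x - b x) ≡ negOnePow m * prodFrom1 m (λ x → b x - a x)
prodFrom1-flip a b zero    = refl
prodFrom1-flip a b (suc m) =
  trans (cong (_* (a (suc m) - b (suc m))) (prodFrom1-flip a b m))
        (flip (negOnePow m) (prodFrom1 m (λ x → b x - a x)) (a (suc m)) (b (suc m)))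
  where
  flip : ∀ s P a b → s * P * (a - b) ≡ - s * (P * (b - a))
  flip = solve-∀

square : ℕ → ℤ
square x = + x * + x

module OddPrime (k : ℕ) (pr : Prime (suc (k ℕ.* 2))) where

  p : ℕ
  p = suc (k ℕ.* 2)

  k≥1 : 1 ≤ k
  k≥1 = positive k (prime>1 pr)
    where
    positive : ∀ j → 1 < suc (j ℕ.* 2) → 1 ≤ j
    positive zero    (s≤s ())
    positive (suc j) _ = s≤s z≤n

  k+k≡k*2 : k ℕ.+ k ≡ k ℕ.* 2
  k+k≡k*2 = trans (cong (k ℕ.+_) (sym (ℕ.+-identityʳ k))) (ℕ.*-comm 2 k)

  p∤ : ∀ m → 0 < m → m ≤ k ℕ.* 2 → ¬ p ∣ℤ + m
  p∤ m 0<m m≤2k = ∤-small 0<m (s≤s m≤2k)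

  -- The squares 1², ..., k² are pairwise incongruent mod p: for 0 < y < x ≤ k
  -- neither x - y nor x + y is a multiple of p.
  squares-distinct : ∀ x y → 0 < y → y < x → x ≤ k → ¬ p ∣ℤ square x - square y
  squares-distinct x y 0<y y<x x≤k p∣x²-y² =
    [ p∤x-y , p∤x+y ]′ (euclid pr (+ x - + y) (+ x + + y) (subst (p ∣ℤ_) (difference (+ x) (+ y)) p∣x²-y²))
    where
    difference : ∀ x y → x * x - y * y ≡ (x - y) * (x + y)
    difference = solve-∀
    p∤x-y : ¬ p ∣ℤ + x - + y
    p∤x-y = subst (λ z → ¬ p ∣ℤ z) (sym (trans (m-n≡m⊖n x y) (⊖-≥ (ℕ.<⇒≤ y<x))))
      (p∤ (x ℕ.∸ y) (ℕ.m<n⇒0<n∸m y<x) (ℕ.≤-trans (ℕ.m∸n≤m x y) (ℕ.≤-trans x≤k (ℕ.m≤m*n k 2))))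
    p∤x+y : ¬ p ∣ℤ + x + + y
    p∤x+y = p∤ (x ℕ.+ y) (ℕ.<-≤-trans 0<y (ℕ.m≤n+m y x))
      (subst (x ℕ.+ y ≤_) k+k≡k*2 (ℕ.+-mono-≤ x≤k (ℕ.≤-trans (ℕ.<⇒≤ y<x) x≤k)))

  residueProduct : ℤ → ℤ
  residueProduct t = prodFrom1 k (λ x → t - square x)

  -- ∏_{x=1}^{k} (t - x²) ≡ t^k - 1 (mod p) for every t: the difference has degree < k
  -- and vanishes at the k distinct squares, where both sides are 0 by Fermat.
  residueProduct≡ : ∀ t → p ∣ℤ residueProduct t - (t ^ k - 1ℤ)
  residueProduct≡ = rootBound pr k (λ i → square (suc i)) distinct degree vanishes
    where
    distinct : ∀ i j → j < i → i < k → ¬ p ∣ℤ square (suc i) - square (suc j)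
    distinct i j j<i i<k = squares-distinct (suc i) (suc j) (s≤s z≤n) (s≤s j<i) i<k
    regroup : ∀ P T → (P - T) + 1ℤ ≡ P - (T - 1ℤ)
    regroup = solve-∀
    degree : DegreeBelow k (λ t → residueProduct t - (t ^ k - 1ℤ))
    degree = deg-ext (λ t → regroup (residueProduct t) (t ^ k))
      (deg-+ (deg-monicProduct square k) (deg-weaken k≥1 (deg-const 1ℤ)))
    vanishes : ∀ i → i < k → p ∣ℤ residueProduct (square (suc i)) - (square (suc i) ^ k - 1ℤ)
    vanishes i i<k = subst (p ∣ℤ_) (sym (cong (_- T) root)) (subst (p ∣ℤ_) (negate T) (∣m⇒∣-m unit))
      where
      x = suc i
      T = square x ^ k - 1ℤ
      root : residueProduct (square x) ≡ 0ℤ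
      root = prodFrom1-zero (λ y → square x - square y) (s≤s z≤n) i<k (cancel (square x))
        where
        cancel : ∀ a → a - a ≡ 0ℤ
        cancel = solve-∀
      unit : p ∣ℤ T
      unit = subst (λ z → p ∣ℤ z - 1ℤ) (sym (square^ (+ x) k))
        (fermat-unit pr (+ x) (p∤ x (s≤s z≤n) (ℕ.≤-trans i<k (ℕ.m≤m*n k 2))))
      negate : ∀ T → - T ≡ 0ℤ - T
      negate = solve-∀

  -- By Fermat p divides
  -- d^(2k) - 1 = (d^k - 1)(d^k + 1); if it divided d^k - 1 it would divide
  -- ∏ (d - x²), a product of nonmultiples of p.
  euler : ∀ d → ¬ p ∣ℤ d → (∀ x → ¬ p ∣ℤ square x - d) → p ∣ℤ d ^ k + 1ℤ
  euler d p∤d nonsquare = [ ⊥-elim ∘ p∤dᵏ-1 , id ]′ (euclid pr (d ^ k - 1ℤ) (d ^ k + 1ℤ) p∣d²ᵏ-1)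
    where
    factor : ∀ D → D * (D * 1ℤ) - 1ℤ ≡ (D - 1ℤ) * (D + 1ℤ)
    factor = solve-∀
    p∣d²ᵏ-1 : p ∣ℤ (d ^ k - 1ℤ) * (d ^ k + 1ℤ)
    p∣d²ᵏ-1 = subst (p ∣ℤ_) (trans (cong (_- 1ℤ) (sym (^-*-assoc d k 2))) (factor (d ^ k))) (fermat-unit pr d p∤d)
    p∤residueProduct : ¬ p ∣ℤ residueProduct d
    p∤residueProduct = prime∤prodFrom1 pr (λ x → d - square x) k (λ x → nonsquare x ∘ ∣-flip {x = d})
    regroup : ∀ P D → (P - (D - 1ℤ)) + (D - 1ℤ) ≡ P
    regroup = solve-∀
    p∤dᵏ-1 : ¬ p ∣ℤ d ^ k - 1ℤ
    p∤dᵏ-1 p∣dᵏ-1 = p∤residueProduct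
      (subst (p ∣ℤ_) (regroup (residueProduct d) (d ^ k)) (∣m∣n⇒∣m+n (residueProduct≡ d) p∣dᵏ-1))

  -- The lemma for p = 2k + 1: ∏_{x=1}^{k} (x² - d) = (-1)^k ∏_{x=1}^{k} (d - x²)
  -- ≡ (-1)^k (d^k - 1) ≡ (-1)^k · (-2) (mod p).
  shiftedSquareProduct : ∀ d → ¬ p ∣ℤ d → (∀ x → ¬ p ∣ℤ square x - d) →
                         p ∣ℤ prodFrom1 k (λ x → square x - d) - negOnePow (suc k) * + 2
  shiftedSquareProduct d p∤d nonsquare =
    subst (p ∣ℤ_) (sym rearrange)
      (∣n⇒∣m*n (negOnePow k) (∣m∣n⇒∣m+n (residueProduct≡ d) (euler d p∤d nonsquare)))
    where
    signs : ∀ s P D → s * P - (- s) * + 2 ≡ s * ((P - (D - 1ℤ)) + (D + 1ℤ))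
    signs = solve-∀
    rearrange : prodFrom1 k (λ x → square x - d) - negOnePow (suc k) * + 2
              ≡ negOnePow k * ((residueProduct d - (d ^ k - 1ℤ)) + (d ^ k + 1ℤ))
    rearrange = trans (cong (_- negOnePow (suc k) * + 2) (prodFrom1-flip square (λ _ → d) k))
                      (signs (negOnePow k) (residueProduct d) (d ^ k))

odd≡ : ∀ p → ¬ (2 ∣ p) → p ≡ suc ((p / 2) ℕ.* 2)
odd≡ p p-odd with p % 2 | m%n<n p 2 | m≡m%n+[m/n]*n p 2 | m%n≡0⇒n∣m p 2
... | 0           | _                 | _  | 2∣p = ⊥-elim (p-odd (2∣p refl))
... | 1           | _                 | p≡ | _   = p≡
... | suc (suc _) | ℕ.s≤s (ℕ.s≤s ()) | _  | _

half-double : ∀ j → j ℕ.* 2 / 2 ≡ j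
half-double j = m*n/n≡m j 2

-- The statement for p = 2k + 1, where (p - 1)/2 = k and (p + 1)/2 = k + 1; the
-- unsigned divisibilities of Defs are translated to and from the signed ones used above.
forOddPrime : ∀ k p → p ≡ suc (k ℕ.* 2) → Prime p → (d : ℤ) → LegendreMinusOne p d →
  prodFrom1 ((p ∸ 1) / 2) (λ x → (+ x) * (+ x) - d) ≡ negOnePow ((p ℕ.+ 1) / 2) * (+ 2) [mod p ]
forOddPrime k .(suc (k ℕ.* 2)) refl pr d (p∤d , nonsquare)
  rewrite half-double k | ℕ.+-comm (k ℕ.* 2) 1 | half-double (suc k) =
  ∣⇒∣ᵤ (OddPrime.shiftedSquareProduct k pr d (p∤d ∘ ∣⇒∣ᵤ) (λ x p∣x²-d → nonsquare (+ x , ∣⇒∣ᵤ p∣x²-d)))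

lemma2p3 : (p : ℕ) → Prime p → ¬ (2 ∣ p) → (d : ℤ) → LegendreMinusOne p d →
    prodFrom1 ((p ∸ 1) / 2) (λ x → (+ x) * (+ x) - d) ≡ negOnePow ((p ℕ.+ 1) / 2) * (+ 2) [mod p ]
lemma2p3 p pr p-odd = forOddPrime (p / 2) p (odd≡ p p-odd) pr
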